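{- Let $S=\{x_1,\ldots,x_n\}$ be a gcd-closed set of distinct positive integers and let $1\le i,j\le n$. Suppose $x_i\in D_S(x_j)$, $D_i\cap D_S(x_j)\neq\emptyset$, and let $\mathrm{Min}(D_i\cap D_S(x_j))=\{x_{i,1},\ldots,x_{i,k}\}$. Suppose that, when $k\ge 2$, $|D_{i,r}\cap D_{i,t}\cap G_S(x_j)|\le 1$ for all $1\le r<t\le k$. Then $$c_{ij}=l_i-\sum_{t=1}^{k}l_{i,t}+(k-1),$$ where $l_i=|D_i\cap G_S(x_j)|$ and $l_{i,t}=|D_{i,t}\cap G_S(x_j)|$.
   Context: $\mu$ is the Möbius function. $S$ is gcd-closed if $\gcd(x,y)\in S$ for all $x,y\in S$. For $x<y$ in $S$, $x$ is a greatest-type divisor of $y$ in $S$ if $x\mid y$ and $x\mid z\mid y$, $z\in S$ imply $z\in\{x,y\}$; $G_S(y)$ is the set of greatest-type divisors of $y$ in $S$. If $G_S(x_k)=\{y_{k,1},\ldots,y_{k,m}\}$, then $D_S(x_k)=\{\gcd(y_{k,i_1},\ldots,y_{k,i_r}): 2\le r\le m,\ 1\le i_1<\cdots<i_r\le m\}$. For $x\in S$, the set of proper multiples of $x$ in $S$ is $\{y\in S: x\mid y,\ y>x\}$; $D_i$ denotes this set for $x=x_i$ and $D_{i,t}$ denotes this set for $x=x_{i,t}$. $\mathrm{Min}(A)$ is the set of elements of $A$ minimal with respect to divisibility. $c_{ij}=\sum\mu(d)$ over positive integers $d$ with $dx_i\mid x_j$ and $dx_i\nmid x_t$ for every $x_t\in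 S$ with $x_t<x_j$. -}

module Defs where

open import Data.Nat using (ℕ; zero; suc; _*_; _<_; _≤_; _<?_)
open import Data.Nat.Divisibility using (_∣_; _∣?_)
open import Data.Nat.GCD using (gcd)
open import Data.Nat.Primality using (Prime; prime?)
open import Data.Integer using (ℤ; +_; -_; _+_)
open import Data.Fin using (Fin; toℕ)
open import Data.Fin.Properties using (all?; any?)
open import Data.Fin.Subset using (Subset; _∈_; ∣_∣)
open import Data.Vec using (_∷_; [])
open import Data.Bool using (Bool; true; false; if_then_else_)
open import Data.Product using (_×_; Σ; ∃; _,_)
open import Data.Sum using (_⊎_)
open import Function using (_∘_)
open import Relation.Nullary using (¬_; Dec; yes; no; ¬?; _×-dec_; _⊎-dec_; _→-dec_)
open import Relation.Nullary.Decidable using (⌊_⌋)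
open import Relation.Binary.PropositionalEquality using (_≡_)
open import Data.Nat.Properties using (_≟_)

count : ∀ {n} {P : Fin n → Set} → ((a : Fin n) → Dec (P a)) → ℕ
count {zero} P? = 0
count {suc n} P? with P? Fin.zero
... | yes _ = suc (count (P? ∘ Fin.suc))
... | no _ = count (P? ∘ Fin.suc)

sumℤ : ∀ {k} → (Fin k → ℤ) → ℤ
sumℤ {zero} f = + 0
sumℤ {suc k} f = f Fin.zero + sumℤ (f ∘ Fin.suc)

-- Möbius function
-- μ(d) = 0 if p² ∣ d for some prime p, otherwise (-1)^(number of primes dividing d);
-- μ(1) = 1.  (μ 0 is irrelevant; we set it to 0.)

-- primes p ≤ d (all prime divisors of d ≥ 1 lie in this range)
primeDivisorCount : ℕ → ℕ
primeDivisorCount d = count {suc d} (λ p → prime? (toℕ p) ×-dec (toℕ p ∣? d))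

-- d has a square prime factor (searching primes p ≤ d suffices for d ≥ 1)
hasSquarePrimeFactor : ℕ → Set
hasSquarePrimeFactor d = ∃ λ (p : Fin (suc d)) → Prime (toℕ p) × (toℕ p * toℕ p ∣ d)

hasSquarePrimeFactor? : (d : ℕ) → Dec (hasSquarePrimeFactor d)
hasSquarePrimeFactor? d = any? (λ p → prime? (toℕ p) ×-dec (toℕ p * toℕ p ∣? d))

negOnePow : ℕ → ℤ
negOnePow zero = + 1
negOnePow (suc k) = - negOnePow k

μ : ℕ → ℤ
μ zero = + 0
μ (suc d) with hasSquarePrimeFactor? (suc d)
... | yes _ = + 0
... | no _ = negOnePow (primeDivisorCount (suc d))

module _ {n : ℕ} (x : Fin n → ℕ) where

  GcdClosed : Set
  GcdClosed = ∀ a b → ∃ λ c → x c ≡ gcd (x a) (x b)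

  IsGreatestTypeDivisor : Fin n → Fin n → Set
  IsGreatestTypeDivisor y a =
    x a < x y × x a ∣ x y ×
    (∀ z → x a ∣ x z → x z ∣ x y → (x z ≡ x a) ⊎ (x z ≡ x y))

  IsGreatestTypeDivisor? : ∀ y a → Dec (IsGreatestTypeDivisor y a)
  IsGreatestTypeDivisor? y a =
    (x a <? x y) ×-dec (x a ∣? x y) ×-dec
    all? (λ z → (x a ∣? x z) →-dec ((x z ∣? x y) →-dec ((x z ≟ x a) ⊎-dec (x z ≟ x y))))

  -- gcd of the elements {x a : a ∈ T} (gcd of the empty family is 0)
  gcdOf : Subset n → ℕ
  gcdOf T = go x T
    where
    go : ∀ {m} → (Fin m → ℕ) → Subset m → ℕ
    go f [] = 0
    go f (true ∷ T) = gcd (f Fin.zero) (go (f ∘ Fin.suc) T)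
    go f (false ∷ T) = go (f ∘ Fin.suc) T

  InD : Fin n → ℕ → Set
  InD y v = Σ (Subset n) λ T →
    (∀ a → a ∈ T → IsGreatestTypeDivisor y a) × 2 ≤ ∣ T ∣ × gcdOf T ≡ v

  IsProperMultiple : Fin n → Fin n → Set
  IsProperMultiple a b = x a ∣ x b × x a < x b

  IsProperMultiple? : ∀ a b → Dec (IsProperMultiple a b)
  IsProperMultiple? a b = (x a ∣? x b) ×-dec (x a <? x b)

  InMinDiDj : Fin n → Fin n → Fin n → Set
  InMinDiDj i j b =
    (IsProperMultiple i b × InD j (x b)) ×
    (∀ c → IsProperMultiple i c → InD j (x c) → x c ∣ x b → c ≡ b)

  lCount : Fin n → Fin n → ℕ
  lCount j a = count (λ b → IsProperMultiple? a b ×-dec IsGreatestTypeDivisor? j b)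

  lCount2 : Fin n → Fin n → Fin n → ℕ
  lCount2 j a b = count (λ c → IsProperMultiple? a c ×-dec IsProperMultiple? b c ×-dec IsGreatestTypeDivisor? j c)

  CCond : Fin n → Fin n → ℕ → Set
  CCond i j d = d * x i ∣ x j × (∀ t → x t < x j → ¬ (d * x i ∣ x t))

  CCond? : ∀ i j d → Dec (CCond i j d)
  CCond? i j d = (d * x i ∣? x j) ×-dec all? (λ t → (x t <? x j) →-dec ¬? (d * x i ∣? x t))

  -- c_ij = Σ μ(d) over positive d with the condition; such d satisfy d ≤ x_j
  -- (as x_j > 0), so we sum over d = 1, …, x_j.
  cEntry : Fin n → Fin n → ℤ
  cEntry i j = sumℤ {x j} (λ e → if ⌊ CCond? i j (suc (toℕ e)) ⌋ then μ (suc (toℕ e)) else + 0)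

-- Write A = D_i ∩ G_S(x_j) and, for a list T of elements of A,
-- gcdTop T = gcd({x_y | y ∈ T} ∪ {x_j}).  The proof has three steps.
-- 1. d·x_i divides no x_t < x_j of S iff it divides x_j but no element of A, since by
--    gcd-closedness every proper divisor of x_j in S lies below a greatest-type divisor.
--    Inclusion–exclusion over sub-lists of A and Σ_{d ∣ K} μ(d) = [K = 1] give
--      c_ij = Σ_{T ⊆ A} (-1)^|T| [gcdTop T = x_i].
-- 2. For |T| ≥ 2, gcdTop T ∈ D_S(x_j); unless it equals x_i it lies above a minimal element
--    x_{i,t}, and T ⊆ D_{i,t} holds for exactly that t (uniqueness is the hypothesis
--    |D_{i,r} ∩ D_{i,t} ∩ G_S(x_j)| ≤ 1).  So [gcdTop T = x_i] equals
--      [|T| ≥ 2, T ⊆ D_i] - Σ_t [|T| ≥ 2, T ⊆ D_{i,t}].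
-- 3. Σ_{T ⊆ A} (-1)^|T| [|T| ≥ 2, T ⊆ D_a] = |A ∩ D_a| - 1 = l_a - 1, which yields the formula.
module Submission where

open import Defs
open import Data.Nat using (ℕ; _<_; _≤_)
open import Data.Integer using (ℤ; +_; _+_; _-_)
open import Data.Fin using (Fin) renaming (_<_ to _<ᶠ_)
open import Data.Product using (_×_; ∃)
open import Relation.Binary.PropositionalEquality using (_≡_)
open import Function using (Injective; _⇔_)

open import Data.Nat as ℕ using (zero; suc; z≤n; s≤s; NonZero; _*_)
import Data.Nat.Properties as ℕₚ
open import Data.Nat.Divisibility
  using (_∣_; _∣?_; divides; ∣-refl; ∣-trans; ∣-antisym; _∣0; ∣⇒≤; n∣m*n; m∣m*n; ∣m+n∣m⇒∣n; ∣m∣n⇒∣m+n;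
         *-monoʳ-∣; *-monoˡ-∣; *-cancelˡ-∣; *-cancelʳ-∣)
open import Data.Nat.GCD using (gcd; gcd[m,n]∣m; gcd[m,n]∣n; gcd-greatest)
open import Data.Nat.Coprimality using (Coprime; coprime-divisor)
open import Data.Nat.Primality using (Prime; prime?; prime⇒nonZero; prime⇒nonTrivial; prime⇒irreducible; euclidsLemma)
open import Data.Nat.Primality.Factorisation using (factorise)
import Data.Integer as ℤ
import Data.Integer.Properties as ℤₚ
open import Data.Integer.Tactic.RingSolver using (solve-∀)
open import Data.Fin using (toℕ; fromℕ<) renaming (zero to fzero; suc to fsuc)
import Data.Fin.Properties as Finₚ
open import Data.Fin.Subset using (Subset; ∣_∣) renaming (_∈_ to _∈ₛ_; _-_ to _-ₛ_)
open import Data.Fin.Subset.Properties using (x∈p⇒∣p-x∣<∣p∣; x∈p∧x≢y⇒x∈p-y)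
open import Data.Vec using ([]; _∷_; here; there)
open import Data.List using (List; []; _∷_; length; filter; tabulate; allFin)
open import Data.List.Membership.Propositional using () renaming (_∈_ to _∈ₗ_)
open import Data.List.Membership.Propositional.Properties using (∈-filter⁺; ∈-filter⁻; ∈-allFin)
open import Data.List.Relation.Unary.Any using (here; there)
open import Data.List.Relation.Unary.All as All using (All; []; _∷_)
open import Data.List.Relation.Unary.AllPairs using ([]; _∷_)
open import Data.List.Relation.Unary.Unique.Propositional using (Unique)
open import Data.List.Relation.Unary.Unique.Propositional.Properties using (filter⁺; allFin⁺)
open import Data.Bool using (true; false; if_then_else_)
open import Data.Product using (_,_; proj₁; proj₂)
open import Data.Sum using (_⊎_; inj₁; inj₂; reduce)
open import Data.Empty using (⊥; ⊥-elim)
open import Relation.Nullary using (¬_; Dec; yes; no; does; ¬?; _×-dec_; _⊎-dec_; _→-dec_)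
open import Relation.Nullary.Decidable using (⌊_⌋; decidable-stable)
open import Relation.Binary using (tri<; tri≈; tri>)
open import Relation.Binary.PropositionalEquality using (_≢_; refl; sym; trans; cong; cong₂; subst; module ≡-Reasoning)
open import Function using (_∘_; Equivalence)

-- [P]·v : the value v if P holds, 0 otherwise.  This is literally the shape
-- of the summands of cEntry, so cEntry is a sum of guarded Möbius values.
when : ∀ {p} {P : Set p} → Dec P → ℤ → ℤ
when D v = if ⌊ D ⌋ then v else + 0

when-yes : ∀ {p} {P : Set p} (D : Dec P) {v} → P → when D v ≡ v
when-yes (yes _) _ = refl
when-yes (no ¬p) p = ⊥-elim (¬p p)

when-no : ∀ {p} {P : Set p} (D : Dec P) {v} → ¬ P → when D v ≡ + 0
when-no (yes p) ¬p = ⊥-elim (¬p p)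
when-no (no _) _ = refl

when-⇔ : ∀ {p q} {P : Set p} {Q : Set q} (D : Dec P) (E : Dec Q) {v} →
  (P → Q) → (Q → P) → when D v ≡ when E v
when-⇔ (yes p) E f g = sym (when-yes E (f p))
when-⇔ (no ¬p) E f g = sym (when-no E (¬p ∘ g))

when-0 : ∀ {p} {P : Set p} (D : Dec P) → when D (+ 0) ≡ + 0
when-0 (yes _) = refl
when-0 (no _) = refl

when-× : ∀ {p q r} {P : Set p} {Q : Set q} {R : Set r} (D : Dec R) (E : Dec P) (F : Dec Q) {v} →
  (R → P × Q) → (P → Q → R) → when D v ≡ when E (when F v)
when-× D (yes p) F f g = when-⇔ D F (proj₂ ∘ f) (g p)
when-× D (no ¬p) F f g = when-no D (¬p ∘ proj₁ ∘ f)

when-comm : ∀ {p q} {P : Set p} {Q : Set q} (D : Dec P) (E : Dec Q) {v} →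
  when D (when E v) ≡ when E (when D v)
when-comm (yes _) E = refl
when-comm (no _) E = sym (when-0 E)

-- sumBelow B f = Σ_{e < B} f e.  Sums over ranges are easier to split and
-- reindex than the Fin-indexed sumℤ used in cEntry.
sumBelow : ℕ → (ℕ → ℤ) → ℤ
sumBelow zero f = + 0
sumBelow (suc B) f = f 0 + sumBelow B (f ∘ suc)

sumℤ≡sumBelow : ∀ B (f : ℕ → ℤ) → sumℤ {B} (f ∘ toℕ) ≡ sumBelow B f
sumℤ≡sumBelow zero f = refl
sumℤ≡sumBelow (suc B) f = cong (_+_ (f 0)) (sumℤ≡sumBelow B (f ∘ suc))

sumBelow-cong : ∀ B {f g : ℕ → ℤ} → (∀ e → e < B → f e ≡ g e) → sumBelow B f ≡ sumBelow B g
sumBelow-cong zero h = refl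
sumBelow-cong (suc B) h = cong₂ _+_ (h 0 (s≤s z≤n)) (sumBelow-cong B (λ e → h (suc e) ∘ s≤s))

sumBelow-0 : ∀ B {f : ℕ → ℤ} → (∀ e → e < B → f e ≡ + 0) → sumBelow B f ≡ + 0
sumBelow-0 B {f} h = trans (sumBelow-cong B h) (zeros B)
  where
  zeros : ∀ B → sumBelow B (λ _ → + 0) ≡ + 0
  zeros zero = refl
  zeros (suc B) = cong (_+_ (+ 0)) (zeros B)

sumBelow-+ : ∀ B (f g : ℕ → ℤ) → sumBelow B (λ e → f e + g e) ≡ sumBelow B f + sumBelow B g
sumBelow-+ zero f g = refl
sumBelow-+ (suc B) f g =
  trans (cong (_+_ (f 0 + g 0)) (sumBelow-+ B (f ∘ suc) (g ∘ suc)))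
        (interchange (f 0) (g 0) (sumBelow B (f ∘ suc)) (sumBelow B (g ∘ suc)))
  where
  interchange : ∀ a b c d → a + b + (c + d) ≡ a + c + (b + d)
  interchange = solve-∀

sumBelow-split : ∀ a b (f : ℕ → ℤ) → sumBelow (a ℕ.+ b) f ≡ sumBelow a f + sumBelow b (λ e → f (a ℕ.+ e))
sumBelow-split zero b f = sym (ℤₚ.+-identityˡ _)
sumBelow-split (suc a) b f = trans (cong (_+_ (f 0)) (sumBelow-split a b (f ∘ suc))) (sym (ℤₚ.+-assoc (f 0) _ _))

sumBelow-truncate : ∀ a B (f : ℕ → ℤ) → a ≤ B → (∀ e → a ≤ e → f e ≡ + 0) → sumBelow B f ≡ sumBelow a f
sumBelow-truncate a B f a≤B tail = begin
  sumBelow B f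
    ≡⟨ cong (λ z → sumBelow z f) (sym (ℕₚ.m+[n∸m]≡n a≤B)) ⟩
  sumBelow (a ℕ.+ (B ℕ.∸ a)) f
    ≡⟨ sumBelow-split a (B ℕ.∸ a) f ⟩
  sumBelow a f + sumBelow (B ℕ.∸ a) (λ e → f (a ℕ.+ e))
    ≡⟨ cong (_+_ (sumBelow a f)) (sumBelow-0 (B ℕ.∸ a) (λ e _ → tail (a ℕ.+ e) (ℕₚ.m≤m+n a e))) ⟩
  sumBelow a f + + 0
    ≡⟨ ℤₚ.+-identityʳ _ ⟩
  sumBelow a f ∎
  where open ≡-Reasoning

sumBelow-last : ∀ B (f : ℕ → ℤ) → sumBelow (suc B) f ≡ sumBelow B f + f B
sumBelow-last zero f = trans (ℤₚ.+-identityʳ (f 0)) (sym (ℤₚ.+-identityˡ (f 0)))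
sumBelow-last (suc B) f = trans (cong (_+_ (f 0)) (sumBelow-last B (f ∘ suc))) (sym (ℤₚ.+-assoc (f 0) _ _))

-- countBelow B P? = #{v < B | P v}; the number of primes dividing d is such a count.
countBelow : (B : ℕ) {P : ℕ → Set} → (∀ v → Dec (P v)) → ℕ
countBelow zero P? = 0
countBelow (suc B) P? with P? 0
... | yes _ = suc (countBelow B (P? ∘ suc))
... | no _ = countBelow B (P? ∘ suc)

count≡countBelow : ∀ B {P : ℕ → Set} (P? : ∀ v → Dec (P v)) → count {B} (P? ∘ toℕ) ≡ countBelow B P?
count≡countBelow zero P? = refl
count≡countBelow (suc B) P? with P? 0
... | yes _ = cong suc (count≡countBelow B (P? ∘ suc))
... | no _ = count≡countBelow B (P? ∘ suc)

countBelow-cong : ∀ B {P Q : ℕ → Set} (P? : ∀ v → Dec (P v)) (Q? : ∀ v → Dec (Q v)) →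
  (∀ v → v < B → P v → Q v) → (∀ v → v < B → Q v → P v) → countBelow B P? ≡ countBelow B Q?
countBelow-cong zero P? Q? f g = refl
countBelow-cong (suc B) P? Q? f g with P? 0 | Q? 0
... | yes p | yes q = cong suc (countBelow-cong B _ _ (λ v → f (suc v) ∘ s≤s) (λ v → g (suc v) ∘ s≤s))
... | no _ | no _ = countBelow-cong B _ _ (λ v → f (suc v) ∘ s≤s) (λ v → g (suc v) ∘ s≤s)
... | yes p | no ¬q = ⊥-elim (¬q (f 0 (s≤s z≤n) p))
... | no ¬p | yes q = ⊥-elim (¬p (g 0 (s≤s z≤n) q))

countBelow-0 : ∀ B {P : ℕ → Set} (P? : ∀ v → Dec (P v)) → (∀ v → v < B → ¬ P v) → countBelow B P? ≡ 0
countBelow-0 zero P? h = refl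
countBelow-0 (suc B) P? h with P? 0
... | yes p = ⊥-elim (h 0 (s≤s z≤n) p)
... | no _ = countBelow-0 B _ (λ v → h (suc v) ∘ s≤s)

countBelow-split : ∀ a b {P : ℕ → Set} (P? : ∀ v → Dec (P v)) →
  countBelow (a ℕ.+ b) P? ≡ countBelow a P? ℕ.+ countBelow b (λ v → P? (a ℕ.+ v))
countBelow-split zero b P? = refl
countBelow-split (suc a) b P? with P? 0
... | yes _ = cong suc (countBelow-split a b (P? ∘ suc))
... | no _ = countBelow-split a b (P? ∘ suc)

countBelow-truncate : ∀ a B {P : ℕ → Set} (P? : ∀ v → Dec (P v)) → a ≤ B → (∀ v → a ≤ v → ¬ P v) →
  countBelow B P? ≡ countBelow a P?
countBelow-truncate a B P? a≤B beyond = begin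
  countBelow B P?
    ≡⟨ cong (λ z → countBelow z P?) (sym (ℕₚ.m+[n∸m]≡n a≤B)) ⟩
  countBelow (a ℕ.+ (B ℕ.∸ a)) P?
    ≡⟨ countBelow-split a (B ℕ.∸ a) P? ⟩
  countBelow a P? ℕ.+ countBelow (B ℕ.∸ a) (λ v → P? (a ℕ.+ v))
    ≡⟨ cong (countBelow a P? ℕ.+_) (countBelow-0 (B ℕ.∸ a) (λ v → P? (a ℕ.+ v)) (λ v _ → beyond (a ℕ.+ v) (ℕₚ.m≤m+n a v))) ⟩
  countBelow a P? ℕ.+ 0
    ≡⟨ ℕₚ.+-identityʳ _ ⟩
  countBelow a P? ∎
  where open ≡-Reasoning

countBelow-⊎ : ∀ B {P Q : ℕ → Set} (P? : ∀ v → Dec (P v)) (Q? : ∀ v → Dec (Q v)) →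
  (∀ v → P v → ¬ Q v) → countBelow B (λ v → P? v ⊎-dec Q? v) ≡ countBelow B P? ℕ.+ countBelow B Q?
countBelow-⊎ zero P? Q? d = refl
countBelow-⊎ (suc B) P? Q? d with P? 0 | Q? 0
... | yes p | yes q = ⊥-elim (d 0 p q)
... | yes p | no q = cong suc (countBelow-⊎ B _ _ (d ∘ suc))
... | no p | yes q = trans (cong suc (countBelow-⊎ B _ _ (d ∘ suc))) (sym (ℕₚ.+-suc _ _))
... | no p | no q = countBelow-⊎ B _ _ (d ∘ suc)

countBelow-≡ : ∀ B p → p < B → countBelow B (ℕₚ._≟ p) ≡ 1
countBelow-≡ (suc B) zero _ = cong suc (countBelow-0 B _ (λ v _ ()))
countBelow-≡ (suc B) (suc p) (s≤s p<B) =
  trans (countBelow-cong B _ _ (λ v _ → ℕₚ.suc-injective) (λ v _ → cong suc)) (countBelow-≡ B p p<B)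

-- Unbounded form of hasSquarePrimeFactor.
HasSquareFactor : ℕ → Set
HasSquareFactor N = ∃ λ q → Prime q × q * q ∣ N

HasSquareFactor⇒hasSquarePrimeFactor : ∀ N → 0 < N → HasSquareFactor N → hasSquarePrimeFactor N
HasSquareFactor⇒hasSquarePrimeFactor N N>0 (q , q-prime , qq∣N) =
  fromℕ< (s≤s q≤N) , subst Prime (sym toℕ-q) q-prime , subst (λ v → v * v ∣ N) (sym toℕ-q) qq∣N
  where
  q≤N : q ≤ N
  q≤N = ℕₚ.≤-trans (ℕₚ.m≤m*n q q {{prime⇒nonZero q-prime}}) (∣⇒≤ {{ℕ.>-nonZero N>0}} qq∣N)
  toℕ-q : toℕ (fromℕ< (s≤s q≤N)) ≡ q
  toℕ-q = Finₚ.toℕ-fromℕ< (s≤s q≤N)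

μ-cases : ∀ N → 0 < N →
  (HasSquareFactor N × μ N ≡ + 0) ⊎ (¬ HasSquareFactor N × μ N ≡ negOnePow (primeDivisorCount N))
μ-cases (suc N) _ with hasSquarePrimeFactor? (suc N)
... | yes (q , q-prime , qq∣N) = inj₁ ((toℕ q , q-prime , qq∣N) , refl)
... | no ¬sq = inj₂ ((¬sq ∘ HasSquareFactor⇒hasSquarePrimeFactor (suc N) (s≤s z≤n)) , refl)

prime∣prime⇒≡ : ∀ {p q} → Prime p → Prime q → p ∣ q → p ≡ q
prime∣prime⇒≡ p-prime q-prime p∣q with prime⇒irreducible q-prime p∣q
... | inj₁ p≡1 = ⊥-elim (ℕ.nonTrivial⇒≢1 {{prime⇒nonTrivial p-prime}} p≡1)
... | inj₂ p≡q = p≡q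

∣p*d⇒∣d : ∀ {p m d} → Prime p → ¬ p ∣ m → m ∣ p * d → m ∣ d
∣p*d⇒∣d {p} {m} p-prime p∤m m∣pd = coprime-divisor coprime m∣pd
  where
  coprime : Coprime m p
  coprime (c∣m , c∣p) with prime⇒irreducible p-prime c∣p
  ... | inj₁ c≡1 = c≡1
  ... | inj₂ refl = ⊥-elim (p∤m c∣m)

p*d>0 : ∀ {p d} → Prime p → 0 < d → 0 < p * d
p*d>0 {p} {d} p-prime d>0 = ℕ.>-nonZero⁻¹ (p * d) {{ℕₚ.m*n≢0 p d {{prime⇒nonZero p-prime}} {{ℕ.>-nonZero d>0}}}}

μ[p*d]≡0 : ∀ p d → Prime p → 0 < d → p ∣ d → μ (p * d) ≡ + 0
μ[p*d]≡0 p d p-prime d>0 p∣d with μ-cases (p * d) (p*d>0 p-prime d>0)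
... | inj₁ (_ , μ≡0) = μ≡0
... | inj₂ (¬sq , _) = ⊥-elim (¬sq (p , p-prime , *-monoʳ-∣ p p∣d))

module _ {p d : ℕ} (p-prime : Prime p) (d>0 : 0 < d) (p∤d : ¬ p ∣ d) where
  private
    instance
      p≢0 : NonZero p
      p≢0 = prime⇒nonZero p-prime
      d≢0 : NonZero d
      d≢0 = ℕ.>-nonZero d>0

  squareFactor-p*d⇒d : HasSquareFactor (p * d) → HasSquareFactor d
  squareFactor-p*d⇒d (q , q-prime , qq∣pd) with p ∣? q * q
  ... | no p∤qq = q , q-prime , ∣p*d⇒∣d p-prime p∤qq qq∣pd
  ... | yes p∣qq with prime∣prime⇒≡ p-prime q-prime (reduce (euclidsLemma q q p-prime p∣qq))
  ... | refl = ⊥-elim (p∤d (*-cancelˡ-∣ p qq∣pd))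

  squareFactor-d⇒p*d : HasSquareFactor d → HasSquareFactor (p * d)
  squareFactor-d⇒p*d (q , q-prime , qq∣d) = q , q-prime , ∣-trans qq∣d (n∣m*n p)

  private
    PrimeDivisor : ℕ → ℕ → Set
    PrimeDivisor M v = Prime v × v ∣ M

    primeDivisor? : ∀ M v → Dec (PrimeDivisor M v)
    primeDivisor? M v = prime? v ×-dec (v ∣? M)

    -- primes dividing d lie below d + 1
    primeDivisorCount-extend : ∀ B → d ≤ B → countBelow (suc B) (primeDivisor? d) ≡ primeDivisorCount d
    primeDivisorCount-extend B d≤B =
      trans (countBelow-truncate (suc d) (suc B) (primeDivisor? d) (s≤s d≤B)
               (λ v d<v (_ , v∣d) → ℕₚ.<⇒≱ d<v (∣⇒≤ v∣d)))
            (sym (count≡countBelow (suc d) (primeDivisor? d)))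

  -- The prime divisors of p·d are those of d together with p.
  primeDivisorCount-p*d : primeDivisorCount (p * d) ≡ suc (primeDivisorCount d)
  primeDivisorCount-p*d = begin
    primeDivisorCount (p * d)
      ≡⟨ count≡countBelow (suc (p * d)) (primeDivisor? (p * d)) ⟩
    countBelow (suc (p * d)) (primeDivisor? (p * d))
      ≡⟨ countBelow-cong (suc (p * d)) (primeDivisor? (p * d)) (λ v → primeDivisor? d v ⊎-dec (v ℕₚ.≟ p)) split join ⟩
    countBelow (suc (p * d)) (λ v → primeDivisor? d v ⊎-dec (v ℕₚ.≟ p))
      ≡⟨ countBelow-⊎ (suc (p * d)) (primeDivisor? d) (ℕₚ._≟ p) (λ { v (_ , v∣d) refl → p∤d v∣d }) ⟩
    countBelow (suc (p * d)) (primeDivisor? d) ℕ.+ countBelow (suc (p * d)) (ℕₚ._≟ p)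
      ≡⟨ cong₂ ℕ._+_ (primeDivisorCount-extend (p * d) (ℕₚ.m≤n*m d p)) (countBelow-≡ (suc (p * d)) p (s≤s (ℕₚ.m≤m*n p d))) ⟩
    primeDivisorCount d ℕ.+ 1
      ≡⟨ ℕₚ.+-comm _ 1 ⟩
    suc (primeDivisorCount d) ∎
    where
    open ≡-Reasoning
    split : ∀ v → v < suc (p * d) → PrimeDivisor (p * d) v → PrimeDivisor d v ⊎ v ≡ p
    split v _ (v-prime , v∣pd) with euclidsLemma p d v-prime v∣pd
    ... | inj₁ v∣p = inj₂ (prime∣prime⇒≡ v-prime p-prime v∣p)
    ... | inj₂ v∣d = inj₁ (v-prime , v∣d)
    join : ∀ v → v < suc (p * d) → PrimeDivisor d v ⊎ v ≡ p → PrimeDivisor (p * d) v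
    join v _ (inj₁ (v-prime , v∣d)) = v-prime , ∣-trans v∣d (n∣m*n p)
    join v _ (inj₂ refl) = p-prime , m∣m*n d

  μ[p*d]≡-μ[d] : μ (p * d) ≡ ℤ.- μ d
  μ[p*d]≡-μ[d] with μ-cases (p * d) (p*d>0 p-prime d>0) | μ-cases d d>0
  ... | inj₁ (_ , μpd≡0) | inj₁ (_ , μd≡0) rewrite μpd≡0 | μd≡0 = refl
  ... | inj₂ (_ , μpd≡) | inj₂ (_ , μd≡) rewrite μpd≡ | μd≡ | primeDivisorCount-p*d = refl
  ... | inj₁ (sq , _) | inj₂ (¬sq , _) = ⊥-elim (¬sq (squareFactor-p*d⇒d sq))
  ... | inj₂ (¬sq , _) | inj₁ (sq , _) = ⊥-elim (¬sq (squareFactor-d⇒p*d sq))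

primeFactor : ∀ K → 1 < K → ∃ λ p → Prime p × p ∣ K
primeFactor K@(suc _) 1<K with factorise K
... | record { factors = [] ; isFactorisation = K≡1 } = ⊥-elim (ℕₚ.<-irrefl (sym K≡1) 1<K)
... | record { factors = p ∷ _ ; isFactorisation = K≡Πps ; factorsPrime = p-prime ∷ _ } =
  p , p-prime , subst (p ∣_) (sym K≡Πps) (m∣m*n _)

sumBelow-multiples : ∀ p K (u : ℕ → ℤ) → 0 < p →
  sumBelow (p * K) (λ e → when (p ∣? suc e) (u (suc e))) ≡ sumBelow K (λ e → u (p * suc e))
sumBelow-multiples p zero u _ rewrite ℕₚ.*-zeroʳ p = refl
sumBelow-multiples p@(suc p-1) (suc K) u p>0 = begin
  sumBelow (p * suc K) f
    ≡⟨ trans (cong (λ z → sumBelow z f) (ℕₚ.*-suc p K)) (sumBelow-split p (p * K) f) ⟩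
  sumBelow p f + sumBelow (p * K) (λ e → f (p ℕ.+ e))
    ≡⟨ cong₂ _+_ firstBlock (sumBelow-cong (p * K) (λ e _ → shift e)) ⟩
  u (p * 1) + sumBelow (p * K) (λ e → when (p ∣? suc e) (u (p ℕ.+ suc e)))
    ≡⟨ cong (_+_ (u (p * 1))) (sumBelow-multiples p K (λ d → u (p ℕ.+ d)) p>0) ⟩
  u (p * 1) + sumBelow K (λ e → u (p ℕ.+ p * suc e))
    ≡⟨ cong (_+_ (u (p * 1))) (sumBelow-cong K (λ e _ → cong u (sym (ℕₚ.*-suc p (suc e))))) ⟩
  u (p * 1) + sumBelow K (λ e → u (p * suc (suc e))) ∎
  where
  open ≡-Reasoning
  f : ℕ → ℤ
  f e = when (p ∣? suc e) (u (suc e))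
  -- among 1, …, p only p itself is a multiple of p
  firstBlock : sumBelow p f ≡ u (p * 1)
  firstBlock = begin
    sumBelow p f ≡⟨ sumBelow-last p-1 f ⟩
    sumBelow p-1 f + f p-1
      ≡⟨ cong₂ _+_ (sumBelow-0 p-1 (λ e e<p-1 → when-no (p ∣? suc e) (λ p∣ → ℕₚ.<⇒≱ (s≤s e<p-1) (∣⇒≤ p∣))))
                   (when-yes (p ∣? p) ∣-refl) ⟩
    + 0 + u p ≡⟨ trans (ℤₚ.+-identityˡ _) (cong u (sym (ℕₚ.*-identityʳ p))) ⟩
    u (p * 1) ∎
  shift : ∀ e → f (p ℕ.+ e) ≡ when (p ∣? suc e) (u (p ℕ.+ suc e))
  shift e rewrite sym (ℕₚ.+-suc p e) = when-⇔ (p ∣? p ℕ.+ suc e) (p ∣? suc e) (λ h → ∣m+n∣m⇒∣n h ∣-refl) (∣m∣n⇒∣m+n ∣-refl)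

-- In a divisor sum over p·M the divisors p·d and d cancel: μ(p·d) = -μ(d) when
-- p ∤ d, and μ(p·d) = 0 when p ∣ d (then d is not counted).
μ-cancel : ∀ {p} → Prime p → ∀ M {d} → 0 < d →
  when (p * d ∣? p * M) (μ (p * d)) + when (¬? (p ∣? d)) (when (d ∣? p * M) (μ d)) ≡ + 0
μ-cancel {p} p-prime M {d} d>0 with p ∣? d
... | yes p∣d = trans (ℤₚ.+-identityʳ _)
                  (trans (cong (when (p * d ∣? p * M)) (μ[p*d]≡0 p d p-prime d>0 p∣d)) (when-0 _))
... | no p∤d = begin
  when (p * d ∣? p * M) (μ (p * d)) + when (d ∣? p * M) (μ d)
    ≡⟨ cong₂ _+_ (cong (when (p * d ∣? p * M)) (μ[p*d]≡-μ[d] p-prime d>0 p∤d))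
                 (when-⇔ (d ∣? p * M) (p * d ∣? p * M)
                   (*-monoʳ-∣ p ∘ ∣p*d⇒∣d p-prime p∤d) (λ h → ∣-trans (*-cancelˡ-∣ p {{prime⇒nonZero p-prime}} h) (n∣m*n p))) ⟩
  when (p * d ∣? p * M) (ℤ.- μ d) + when (p * d ∣? p * M) (μ d)
    ≡⟨ opposite (p * d ∣? p * M) (μ d) ⟩
  + 0 ∎
  where
  open ≡-Reasoning
  opposite : ∀ {P : Set} (D : Dec P) v → when D (ℤ.- v) + when D v ≡ + 0
  opposite (yes _) v = ℤₚ.+-inverseˡ v
  opposite (no _) v = refl

möbius-sum : ∀ K → 0 < K → sumBelow K (λ e → when (suc e ∣? K) (μ (suc e))) ≡ when (K ℕₚ.≟ 1) (+ 1)
möbius-sum (suc zero) _ = refl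
möbius-sum K@(suc (suc _)) _ with primeFactor K (s≤s (s≤s z≤n))
... | p , p-prime , divides K′ K≡K′p = trans (cong divisorSum K≡pK′) (divisorSum-pK′≡0 (K′>0 K′ K≡K′p))
  where
  instance
    p≢0 : NonZero p
    p≢0 = prime⇒nonZero p-prime
  p>0 : 0 < p
  p>0 = ℕ.>-nonZero⁻¹ p
  K≡pK′ : K ≡ p * K′
  K≡pK′ = trans K≡K′p (ℕₚ.*-comm K′ p)
  K′>0 : ∀ q → K ≡ q * p → 0 < q
  K′>0 (suc _) _ = s≤s z≤n
  divisorSum : ℕ → ℤ
  divisorSum M = sumBelow M (λ e → when (suc e ∣? M) (μ (suc e)))
  -- split the divisors of p·K′ by whether p divides them and pair p·e with e
  divisorSum-pK′≡0 : 0 < K′ → divisorSum (p * K′) ≡ + 0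
  divisorSum-pK′≡0 K′>0 = begin
    sumBelow (p * K′) (u ∘ suc)
      ≡⟨ sumBelow-cong (p * K′) (λ e _ → split (suc e)) ⟩
    sumBelow (p * K′) (λ e → multiple (suc e) + nonMultiple (suc e))
      ≡⟨ sumBelow-+ (p * K′) (multiple ∘ suc) (nonMultiple ∘ suc) ⟩
    sumBelow (p * K′) (multiple ∘ suc) + sumBelow (p * K′) (nonMultiple ∘ suc)
      ≡⟨ cong₂ _+_ (sumBelow-multiples p K′ u p>0)
                   (sumBelow-truncate K′ (p * K′) (nonMultiple ∘ suc) (ℕₚ.m≤n*m K′ p) nonMultiple-large) ⟩
    sumBelow K′ (λ e → u (p * suc e)) + sumBelow K′ (nonMultiple ∘ suc)
      ≡⟨ sym (sumBelow-+ K′ (λ e → u (p * suc e)) (nonMultiple ∘ suc)) ⟩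
    sumBelow K′ (λ e → u (p * suc e) + nonMultiple (suc e))
      ≡⟨ sumBelow-0 K′ (λ e _ → μ-cancel p-prime K′ (s≤s z≤n)) ⟩
    + 0 ∎
    where
    open ≡-Reasoning
    u : ℕ → ℤ
    u d = when (d ∣? p * K′) (μ d)
    multiple nonMultiple : ℕ → ℤ
    multiple d = when (p ∣? d) (u d)
    nonMultiple d = when (¬? (p ∣? d)) (u d)
    split : ∀ d → u d ≡ multiple d + nonMultiple d
    split d with p ∣? d
    ... | yes _ = sym (ℤₚ.+-identityʳ (u d))
    ... | no _ = sym (ℤₚ.+-identityˡ (u d))
    nonMultiple-large : ∀ e → K′ ≤ e → nonMultiple (suc e) ≡ + 0
    nonMultiple-large e K′≤e with p ∣? suc e
    ... | yes _ = refl
    ... | no p∤ = when-no (suc e ∣? p * K′)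
                    (λ e+1∣pK′ → ℕₚ.<⇒≱ (s≤s K′≤e) (∣⇒≤ {{ℕ.>-nonZero K′>0}} (∣p*d⇒∣d p-prime p∤ e+1∣pK′)))

möbius-sum-scaled : ∀ a M B → 0 < a → a ∣ M → 0 < M → M ≤ B →
  sumBelow B (λ e → when (suc e * a ∣? M) (μ (suc e))) ≡ when (M ℕₚ.≟ a) (+ 1)
möbius-sum-scaled a M B a>0 (divides K refl) M>0 M≤B = begin
  sumBelow B (λ e → when (suc e * a ∣? K * a) (μ (suc e)))
    ≡⟨ sumBelow-cong B (λ e _ → when-⇔ (suc e * a ∣? K * a) (suc e ∣? K) (*-cancelʳ-∣ a) (*-monoˡ-∣ a)) ⟩
  sumBelow B f
    ≡⟨ sumBelow-truncate K B f K≤B (λ e K≤e → when-no (suc e ∣? K) (λ e+1∣K → ℕₚ.<⇒≱ (s≤s K≤e) (∣⇒≤ {{ℕ.>-nonZero K>0}} e+1∣K))) ⟩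
  sumBelow K f
    ≡⟨ möbius-sum K K>0 ⟩
  when (K ℕₚ.≟ 1) (+ 1)
    ≡⟨ when-⇔ (K ℕₚ.≟ 1) (K * a ℕₚ.≟ a) (λ { refl → ℕₚ.*-identityˡ a })
              (λ Ka≡a → ℕₚ.*-cancelʳ-≡ K 1 a (trans Ka≡a (sym (ℕₚ.*-identityˡ a)))) ⟩
  when (K * a ℕₚ.≟ a) (+ 1) ∎
  where
  open ≡-Reasoning
  instance
    a≢0 : NonZero a
    a≢0 = ℕ.>-nonZero a>0
  f : ℕ → ℤ
  f e = when (suc e ∣? K) (μ (suc e))
  K>0 : 0 < K
  K>0 = positiveFactor K M>0
    where
    positiveFactor : ∀ q → 0 < q * a → 0 < q
    positiveFactor (suc _) _ = s≤s z≤n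
  K≤B : K ≤ B
  K≤B = ℕₚ.≤-trans (ℕₚ.m≤m*n K a) M≤B

sumℤ-cong : ∀ k {f g : Fin k → ℤ} → (∀ t → f t ≡ g t) → sumℤ f ≡ sumℤ g
sumℤ-cong zero h = refl
sumℤ-cong (suc k) h = cong₂ _+_ (h fzero) (sumℤ-cong k (h ∘ fsuc))

sumℤ-0 : ∀ k {f : Fin k → ℤ} → (∀ t → f t ≡ + 0) → sumℤ f ≡ + 0
sumℤ-0 zero h = refl
sumℤ-0 (suc k) h = cong₂ _+_ (h fzero) (sumℤ-0 k (h ∘ fsuc))

sumℤ-single : ∀ k {f : Fin k → ℤ} t₀ → f t₀ ≡ + 1 → (∀ t → t ≢ t₀ → f t ≡ + 0) → sumℤ f ≡ + 1
sumℤ-single (suc k) fzero f₀≡1 others = cong₂ _+_ f₀≡1 (sumℤ-0 k (λ t → others (fsuc t) (λ ())))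
sumℤ-single (suc k) (fsuc t₀) f₀≡1 others =
  trans (cong₂ _+_ (others fzero (λ ())) (sumℤ-single k t₀ f₀≡1 (λ t t≢t₀ → others (fsuc t) (t≢t₀ ∘ Finₚ.suc-injective))))
        (ℤₚ.+-identityˡ (+ 1))

sumℤ-minus1 : ∀ k (f : Fin k → ℤ) → sumℤ (λ t → f t - + 1) ≡ sumℤ f - + k
sumℤ-minus1 zero f = refl
sumℤ-minus1 (suc k) f =
  trans (cong (_+_ (f fzero - + 1)) (sumℤ-minus1 k (f ∘ fsuc))) (regroup (f fzero) (sumℤ (f ∘ fsuc)) (+ k))
  where
  regroup : ∀ a b c → a - + 1 + (b - c) ≡ a + b - (+ 1 + c)
  regroup = solve-∀

count-cong : ∀ {m} {P Q : Fin m → Set} (P? : ∀ a → Dec (P a)) (Q? : ∀ a → Dec (Q a)) →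
  (∀ a → P a → Q a) → (∀ a → Q a → P a) → count P? ≡ count Q?
count-cong {zero} P? Q? f g = refl
count-cong {suc m} P? Q? f g with P? fzero | Q? fzero
... | yes _ | yes _ = cong suc (count-cong (P? ∘ fsuc) (Q? ∘ fsuc) (f ∘ fsuc) (g ∘ fsuc))
... | no _ | no _ = count-cong (P? ∘ fsuc) (Q? ∘ fsuc) (f ∘ fsuc) (g ∘ fsuc)
... | yes p | no ¬q = ⊥-elim (¬q (f fzero p))
... | no ¬p | yes q = ⊥-elim (¬p (g fzero q))

length-filter-tabulate : ∀ {m} {X : Set} {P : X → Set} (P? : ∀ a → Dec (P a)) (g : Fin m → X) →
  length (filter P? (tabulate g)) ≡ count (P? ∘ g)
length-filter-tabulate {zero} P? g = refl
length-filter-tabulate {suc m} P? g with P? (g fzero)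
... | yes _ = cong suc (length-filter-tabulate P? (g ∘ fsuc))
... | no _ = length-filter-tabulate P? (g ∘ fsuc)

length-filter-filter : ∀ {X : Set} {P Q : X → Set} (P? : ∀ a → Dec (P a)) (Q? : ∀ a → Dec (Q a)) L →
  length (filter Q? (filter P? L)) ≡ length (filter (λ a → P? a ×-dec Q? a) L)
length-filter-filter P? Q? [] = refl
length-filter-filter P? Q? (y ∷ L) with P? y
... | no _ = length-filter-filter P? Q? L
... | yes _ with Q? y
...   | yes _ = cong suc (length-filter-filter P? Q? L)
...   | no _ = length-filter-filter P? Q? L

length≥1 : ∀ {X : Set} {y : X} {L} → y ∈ₗ L → 1 ≤ length L
length≥1 (here _) = s≤s z≤n
length≥1 (there _) = s≤s z≤n

length≥2 : ∀ {X : Set} {a b : X} {L} → a ∈ₗ L → b ∈ₗ L → a ≢ b → 2 ≤ length L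
length≥2 (here refl) (here refl) a≢b = ⊥-elim (a≢b refl)
length≥2 (here _) (there b∈) _ = s≤s (length≥1 b∈)
length≥2 (there a∈) (here _) _ = s≤s (length≥1 a∈)
length≥2 (there a∈) (there b∈) a≢b = ℕₚ.m≤n⇒m≤1+n (length≥2 a∈ b∈ a≢b)

subsetOf : ∀ {m} {P : Fin m → Set} → (∀ a → Dec (P a)) → Subset m
subsetOf {zero} P? = []
subsetOf {suc m} P? = does (P? fzero) ∷ subsetOf (P? ∘ fsuc)

∈-subsetOf⁺ : ∀ {m} {P : Fin m → Set} (P? : ∀ a → Dec (P a)) {a} → P a → a ∈ₛ subsetOf P?
∈-subsetOf⁺ P? {fzero} pa with P? fzero
... | yes _ = here
... | no ¬pa = ⊥-elim (¬pa pa)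
∈-subsetOf⁺ P? {fsuc a} pa = there (∈-subsetOf⁺ (P? ∘ fsuc) pa)

∈-subsetOf⁻ : ∀ {m} {P : Fin m → Set} (P? : ∀ a → Dec (P a)) {a} → a ∈ₛ subsetOf P? → P a
∈-subsetOf⁻ P? {fzero} a∈ with P? fzero | a∈
... | yes pa | _ = pa
... | no _ | ()
∈-subsetOf⁻ P? {fsuc a} (there a∈) = ∈-subsetOf⁻ (P? ∘ fsuc) a∈

∣U∣≥2 : ∀ {m} (U : Subset m) {a b} → a ∈ₛ U → b ∈ₛ U → a ≢ b → 2 ≤ ∣ U ∣
∣U∣≥2 U {a} {b} a∈U b∈U a≢b = ℕₚ.≤-trans (s≤s (ℕₚ.≤-trans (s≤s z≤n) ∣U-a-b∣<∣U-a∣)) (x∈p⇒∣p-x∣<∣p∣ a∈U)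
  where
  ∣U-a-b∣<∣U-a∣ : ∣ U -ₛ a -ₛ b ∣ < ∣ U -ₛ a ∣
  ∣U-a-b∣<∣U-a∣ = x∈p⇒∣p-x∣<∣p∣ (x∈p∧x≢y⇒x∈p-y b∈U (a≢b ∘ sym))

member : ∀ {m} (U : Subset m) → 1 ≤ ∣ U ∣ → ∃ λ a → a ∈ₛ U
member (true ∷ U) _ = fzero , here
member (false ∷ U) h with member U h
... | a , a∈U = fsuc a , there a∈U

two-members : ∀ {m} (U : Subset m) → 2 ≤ ∣ U ∣ → ∃ λ a → ∃ λ b → a ∈ₛ U × b ∈ₛ U × a ≢ b
two-members (true ∷ U) (s≤s h) with member U h
... | b , b∈U = fzero , fsuc b , here , there b∈U , (λ ())
two-members (false ∷ U) h with two-members U h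
... | a , b , a∈U , b∈U , a≢b = fsuc a , fsuc b , there a∈U , there b∈U , (a≢b ∘ Finₚ.suc-injective)

gcdOf-∣ : ∀ {m} (f : Fin m → ℕ) (U : Subset m) {a} → a ∈ₛ U → gcdOf f U ∣ f a
gcdOf-∣ f (true ∷ U) here = gcd[m,n]∣m (f fzero) (gcdOf (f ∘ fsuc) U)
gcdOf-∣ f (true ∷ U) (there a∈U) = ∣-trans (gcd[m,n]∣n (f fzero) (gcdOf (f ∘ fsuc) U)) (gcdOf-∣ (f ∘ fsuc) U a∈U)
gcdOf-∣ f (false ∷ U) (there a∈U) = gcdOf-∣ (f ∘ fsuc) U a∈U

gcdOf-greatest : ∀ {m} (f : Fin m → ℕ) (U : Subset m) {d} → (∀ a → a ∈ₛ U → d ∣ f a) → d ∣ gcdOf f U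
gcdOf-greatest f [] h = _ ∣0
gcdOf-greatest f (true ∷ U) h = gcd-greatest (h fzero here) (gcdOf-greatest (f ∘ fsuc) U (λ a → h (fsuc a) ∘ there))
gcdOf-greatest f (false ∷ U) h = gcdOf-greatest (f ∘ fsuc) U (λ a → h (fsuc a) ∘ there)

module _ {X : Set} where

  -- altSum L F = Σ_{T sub-list of L} (-1)^|T| F(T)
  altSum : List X → (List X → ℤ) → ℤ
  altSum [] F = F []
  altSum (y ∷ L) F = altSum L F - altSum L (F ∘ (y ∷_))

  altSum-ext : ∀ L {F G : List X → ℤ} → (∀ T → F T ≡ G T) → altSum L F ≡ altSum L G
  altSum-ext [] h = h []
  altSum-ext (y ∷ L) h = cong₂ _-_ (altSum-ext L h) (altSum-ext L (h ∘ (y ∷_)))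

  altSum-cong : ∀ L {F G : List X → ℤ} → Unique L →
    (∀ T → Unique T → All (_∈ₗ L) T → F T ≡ G T) → altSum L F ≡ altSum L G
  altSum-cong [] _ h = h [] [] []
  altSum-cong (y ∷ L) (y∉L ∷ L-unique) h =
    cong₂ _-_ (altSum-cong L L-unique (λ T T-unique T⊆L → h T T-unique (All.map there T⊆L)))
              (altSum-cong L L-unique (λ T T-unique T⊆L →
                 h (y ∷ T) (All.map (All.lookup y∉L) T⊆L ∷ T-unique) (here refl ∷ All.map there T⊆L)))

  altSum-0 : ∀ L → altSum L (λ _ → + 0) ≡ + 0
  altSum-0 [] = refl
  altSum-0 (y ∷ L) = cong₂ _-_ (altSum-0 L) (altSum-0 L)

  altSum-+ : ∀ L (F G : List X → ℤ) → altSum L (λ T → F T + G T) ≡ altSum L F + altSum L G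
  altSum-+ [] F G = refl
  altSum-+ (y ∷ L) F G =
    trans (cong₂ _-_ (altSum-+ L F G) (altSum-+ L (F ∘ (y ∷_)) (G ∘ (y ∷_))))
          (regroup (altSum L F) (altSum L G) _ _)
    where
    regroup : ∀ a b c d → a + b - (c + d) ≡ a - c + (b - d)
    regroup = solve-∀

  altSum-- : ∀ L (F G : List X → ℤ) → altSum L (λ T → F T - G T) ≡ altSum L F - altSum L G
  altSum-- [] F G = refl
  altSum-- (y ∷ L) F G =
    trans (cong₂ _-_ (altSum-- L F G) (altSum-- L (F ∘ (y ∷_)) (G ∘ (y ∷_))))
          (regroup (altSum L F) (altSum L G) _ _)
    where
    regroup : ∀ a b c d → a - b - (c - d) ≡ a - c - (b - d)
    regroup = solve-∀

  altSum-when : ∀ {p} {P : Set p} (D : Dec P) L (F : List X → ℤ) →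
    altSum L (λ T → when D (F T)) ≡ when D (altSum L F)
  altSum-when (yes _) L F = refl
  altSum-when (no _) L F = altSum-0 L

  altSum-sumBelow : ∀ L B (F : ℕ → List X → ℤ) →
    altSum L (λ T → sumBelow B (λ e → F e T)) ≡ sumBelow B (λ e → altSum L (F e))
  altSum-sumBelow L zero F = altSum-0 L
  altSum-sumBelow L (suc B) F =
    trans (altSum-+ L (F 0) (λ T → sumBelow B (λ e → F (suc e) T)))
          (cong (_+_ (altSum L (F 0))) (altSum-sumBelow L B (F ∘ suc)))

  altSum-sumℤ : ∀ L k (F : Fin k → List X → ℤ) →
    altSum L (λ T → sumℤ (λ t → F t T)) ≡ sumℤ (λ t → altSum L (F t))
  altSum-sumℤ L zero F = altSum-0 L
  altSum-sumℤ L (suc k) F =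
    trans (altSum-+ L (F fzero) (λ T → sumℤ (λ t → F (fsuc t) T)))
          (cong (_+_ (altSum L (F fzero))) (altSum-sumℤ L k (F ∘ fsuc)))

  isEmpty : List X → ℤ
  isEmpty [] = + 1
  isEmpty (_ ∷ _) = + 0

  altSum-isEmpty : ∀ L → altSum L isEmpty ≡ + 1
  altSum-isEmpty [] = refl
  altSum-isEmpty (y ∷ L) = cong₂ _-_ (altSum-isEmpty L) (altSum-0 L)

  module _ {Q : X → Set} (Q? : ∀ a → Dec (Q a)) where

    ifAll : List X → ℤ → ℤ
    ifAll [] v = v
    ifAll (y ∷ T) v = when (Q? y) (ifAll T v)

    atMostOne : List X → ℤ
    atMostOne [] = + 1
    atMostOne (y ∷ T) = when (Q? y) (isEmpty T)

    severalAll : List X → ℤ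
    severalAll [] = + 0
    severalAll (_ ∷ []) = + 0
    severalAll T@(_ ∷ _ ∷ _) = ifAll T (+ 1)

    ifAll-yes : ∀ T {v} → All Q T → ifAll T v ≡ v
    ifAll-yes [] [] = refl
    ifAll-yes (y ∷ T) (qy ∷ qT) = trans (when-yes (Q? y) qy) (ifAll-yes T qT)

    ifAll-no : ∀ T {v} → ¬ All Q T → ifAll T v ≡ + 0
    ifAll-no [] ¬all = ⊥-elim (¬all [])
    ifAll-no (y ∷ T) ¬all with Q? y
    ... | yes qy = ifAll-no T (¬all ∘ (qy ∷_))
    ... | no _ = refl

    severalAll≡ifAll-atMostOne : ∀ T → severalAll T ≡ ifAll T (+ 1) - atMostOne T
    severalAll≡ifAll-atMostOne [] = refl
    severalAll≡ifAll-atMostOne (y ∷ []) = sym (ℤₚ.+-inverseʳ (when (Q? y) (+ 1)))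
    severalAll≡ifAll-atMostOne T@(y ∷ _ ∷ _) =
      sym (trans (cong (ifAll T (+ 1) -_) (when-0 (Q? y))) (ℤₚ.+-identityʳ (ifAll T (+ 1))))

    ifAll≡when-all : ∀ T v → ifAll T v ≡ when (All.all? Q? T) v
    ifAll≡when-all T v with All.all? Q? T
    ... | yes all = ifAll-yes T all
    ... | no ¬all = ifAll-no T ¬all

  module _ {Q : X → Set} (Q? : ∀ a → Dec (Q a)) where

    altSum-ifAll : ∀ L v → altSum L (λ T → ifAll Q? T v) ≡ ifAll (¬? ∘ Q?) L v
    altSum-ifAll [] v = refl
    altSum-ifAll (y ∷ L) v with Q? y
    ... | yes _ = ℤₚ.+-inverseʳ (altSum L (λ T → ifAll Q? T v))
    ... | no _ = trans (cong (altSum L (λ T → ifAll Q? T v) -_) (altSum-0 L))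
                       (trans (ℤₚ.+-identityʳ _) (altSum-ifAll L v))

    altSum-atMostOne : ∀ L → altSum L (atMostOne Q?) ≡ + 1 - + length (filter Q? L)
    altSum-atMostOne [] = refl
    altSum-atMostOne (y ∷ L) with Q? y
    ... | yes _ = trans (cong₂ _-_ (altSum-atMostOne L) (altSum-isEmpty L)) (regroup (+ length (filter Q? L)))
      where
      regroup : ∀ c → + 1 - c - + 1 ≡ + 1 - (+ 1 + c)
      regroup = solve-∀
    ... | no _ = trans (cong₂ _-_ (altSum-atMostOne L) (altSum-0 L)) (ℤₚ.+-identityʳ _)

    altSum-severalAll : ∀ L → 1 ≤ length (filter Q? L) → altSum L (severalAll Q?) ≡ + length (filter Q? L) - + 1
    altSum-severalAll L some = begin
      altSum L (severalAll Q?)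
        ≡⟨ altSum-ext L (severalAll≡ifAll-atMostOne Q?) ⟩
      altSum L (λ T → ifAll Q? T (+ 1) - atMostOne Q? T)
        ≡⟨ altSum-- L (λ T → ifAll Q? T (+ 1)) (atMostOne Q?) ⟩
      altSum L (λ T → ifAll Q? T (+ 1)) - altSum L (atMostOne Q?)
        ≡⟨ cong₂ _-_ (trans (altSum-ifAll L (+ 1)) (ifAll-no (¬? ∘ Q?) L (noneFails L some))) (altSum-atMostOne L) ⟩
      + 0 - (+ 1 - + length (filter Q? L))
        ≡⟨ regroup (+ length (filter Q? L)) ⟩
      + length (filter Q? L) - + 1 ∎
      where
      open ≡-Reasoning
      regroup : ∀ c → + 0 - (+ 1 - c) ≡ c - + 1
      regroup = solve-∀
      noneFails : ∀ L → 1 ≤ length (filter Q? L) → ¬ All (¬_ ∘ Q) L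
      noneFails (y ∷ L) some (¬qy ∷ ¬qL) with Q? y
      ... | yes qy = ¬qy qy
      ... | no _ = noneFails L some ¬qL

∣∧≢⇒< : ∀ {u v} → 0 < v → u ∣ v → u ≢ v → u < v
∣∧≢⇒< v>0 u∣v u≢v = ℕₚ.≤∧≢⇒< (∣⇒≤ {{ℕ.>-nonZero v>0}} u∣v) u≢v

counterexample : ∀ {P Q R : Set} → Dec P → Dec Q → ¬ (P → Q → R) → P × Q × ¬ R
counterexample (yes p) (yes q) ¬impl = p , q , (λ r → ¬impl (λ _ _ → r))
counterexample (yes p) (no ¬q) ¬impl = ⊥-elim (¬impl (λ _ q → ⊥-elim (¬q q)))
counterexample (no ¬p) _ ¬impl = ⊥-elim (¬impl (λ p → ⊥-elim (¬p p)))

module GreatestTypeDivisors {n : ℕ} (x : Fin n → ℕ) (x-inj : Injective _≡_ _≡_ x) (x-pos : ∀ a → 0 < x a)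
  (j : Fin n) where

  Gtd : Fin n → Set
  Gtd = IsGreatestTypeDivisor x j

  Gtd-antichain : ∀ {a b} → Gtd a → Gtd b → x a ∣ x b → a ≡ b
  Gtd-antichain {a} {b} (_ , _ , a-maximal) (b<j , b∣j , _) a∣b with a-maximal b a∣b b∣j
  ... | inj₁ xb≡xa = x-inj (sym xb≡xa)
  ... | inj₂ xb≡xj = ⊥-elim (ℕₚ.<⇒≢ b<j xb≡xj)

  D-below-Gtd : ∀ {v} → InD x j v → ∃ λ a → Gtd a × v ∣ x a × v < x a
  D-below-Gtd {v} (U , U⊆G , 2≤∣U∣ , gcdU≡v) with two-members U 2≤∣U∣
  ... | a , b , a∈U , b∈U , a≢b =
    a , U⊆G a a∈U , v∣ a∈U , ∣∧≢⇒< (x-pos a) (v∣ a∈U)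
      (λ v≡xa → a≢b (Gtd-antichain (U⊆G a a∈U) (U⊆G b b∈U) (subst (_∣ x b) v≡xa (v∣ b∈U))))
    where
    v∣ : ∀ {c} → c ∈ₛ U → v ∣ x c
    v∣ c∈U = subst (_∣ x _) gcdU≡v (gcdOf-∣ x U c∈U)

  -- Every proper divisor of x_j in S divides some greatest-type divisor; found by
  -- climbing through intermediate divisors, which are strictly closer to x_j.
  Gtd-above : ∀ c → x c ∣ x j → x c < x j → ∃ λ y → Gtd y × x c ∣ x y
  Gtd-above c = climb (suc (x j ℕ.∸ x c)) c (ℕₚ.n<1+n _)
    where
    between? : ∀ c z → Dec (x c ∣ x z → x z ∣ x j → (x z ≡ x c) ⊎ (x z ≡ x j))
    between? c z = (x c ∣? x z) →-dec ((x z ∣? x j) →-dec ((x z ℕₚ.≟ x c) ⊎-dec (x z ℕₚ.≟ x j)))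
    climb : ∀ fuel c → x j ℕ.∸ x c < fuel → x c ∣ x j → x c < x j → ∃ λ y → Gtd y × x c ∣ x y
    climb (suc fuel) c gap<fuel c∣j c<j with Finₚ.all? (between? c)
    ... | yes c-maximal = c , (c<j , c∣j , c-maximal) , ∣-refl
    ... | no ¬c-maximal with Finₚ.¬∀⟶∃¬ n _ (between? c) ¬c-maximal
    ... | z , ¬between with counterexample (x c ∣? x z) (x z ∣? x j) ¬between
    ... | c∣z , z∣j , z≢c,j with climb fuel z gap′ z∣j z<j
      where
      c<z : x c < x z
      c<z = ∣∧≢⇒< (x-pos z) c∣z (λ xc≡xz → z≢c,j (inj₁ (sym xc≡xz)))
      z<j : x z < x j
      z<j = ∣∧≢⇒< (x-pos j) z∣j (z≢c,j ∘ inj₂)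
      gap′ : x j ℕ.∸ x z < fuel
      gap′ = ℕₚ.<-≤-trans (ℕₚ.∸-monoʳ-< c<z (ℕₚ.<⇒≤ z<j)) (ℕ.s≤s⁻¹ gap<fuel)
    ... | y , y-gtd , z∣y = y , y-gtd , ∣-trans c∣z z∣y

module Entry {n : ℕ} (x : Fin n → ℕ) (x-inj : Injective _≡_ _≡_ x) (x-pos : ∀ a → 0 < x a)
  (closed : GcdClosed x) (i j : Fin n) (xi∈D : InD x j (x i)) where

  open GreatestTypeDivisors x x-inj x-pos j
  open import Data.List.Membership.DecPropositional (Finₚ._≟_ {n}) using (_∈?_)

  -- x b ∈ D_a
  PM : Fin n → Fin n → Set
  PM = IsProperMultiple x

  PM? : ∀ a b → Dec (PM a b)
  PM? = IsProperMultiple? x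

  xi-below : ∃ λ a → Gtd a × x i ∣ x a × x i < x a
  xi-below = D-below-Gtd xi∈D

  xi∣xj : x i ∣ x j
  xi∣xj with xi-below
  ... | _ , (_ , a∣j , _) , xi∣a , _ = ∣-trans xi∣a a∣j

  xi<xj : x i < x j
  xi<xj with xi-below
  ... | _ , (a<j , _) , _ , xi<a = ℕₚ.<-trans xi<a a<j

  xi≢Gtd : ∀ {y} → Gtd y → x i ≢ x y
  xi≢Gtd y-gtd xi≡xy with xi-below
  ... | a , a-gtd , xi∣a , xi<a with Gtd-antichain y-gtd a-gtd (subst (_∣ x a) xi≡xy xi∣a)
  ... | refl = ℕₚ.<⇒≢ xi<a xi≡xy

  Gtd⇒PM : ∀ {y} → Gtd y → x i ∣ x y → PM i y
  Gtd⇒PM {y} y-gtd xi∣xy = xi∣xy , ∣∧≢⇒< (x-pos y) xi∣xy (xi≢Gtd y-gtd)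

  A? : ∀ b → Dec (PM i b × Gtd b)
  A? b = PM? i b ×-dec IsGreatestTypeDivisor? x j b

  A : List (Fin n)
  A = filter A? (allFin n)

  A-unique : Unique A
  A-unique = filter⁺ A? (allFin⁺ n)

  ∈A⁺ : ∀ {b} → PM i b → Gtd b → b ∈ₗ A
  ∈A⁺ {b} b∈Di b-gtd = ∈-filter⁺ A? (∈-allFin b) (b∈Di , b-gtd)

  ∈A⁻ : ∀ {b} → b ∈ₗ A → PM i b × Gtd b
  ∈A⁻ = proj₂ ∘ ∈-filter⁻ A? {xs = allFin n}

  count-A∩D : ∀ a → (∀ {b} → PM a b → PM i b) → length (filter (PM? a) A) ≡ lCount x j a
  count-A∩D a Da⊆Di = begin
    length (filter (PM? a) A)
      ≡⟨ length-filter-filter A? (PM? a) (allFin n) ⟩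
    length (filter (λ b → A? b ×-dec PM? a b) (allFin n))
      ≡⟨ length-filter-tabulate (λ b → A? b ×-dec PM? a b) (λ b → b) ⟩
    count (λ b → A? b ×-dec PM? a b)
      ≡⟨ count-cong (λ b → A? b ×-dec PM? a b) (λ b → PM? a b ×-dec IsGreatestTypeDivisor? x j b)
           (λ { b ((_ , b-gtd) , b∈Da) → b∈Da , b-gtd }) (λ { b (b∈Da , b-gtd) → (Da⊆Di b∈Da , b-gtd) , b∈Da }) ⟩
    lCount x j a ∎
    where open ≡-Reasoning

  gcdTop : List (Fin n) → ℕ
  gcdTop [] = x j
  gcdTop (a ∷ T) = gcd (x a) (gcdTop T)

  gcdTop-∣top : ∀ T → gcdTop T ∣ x j
  gcdTop-∣top [] = ∣-refl
  gcdTop-∣top (a ∷ T) = ∣-trans (gcd[m,n]∣n (x a) (gcdTop T)) (gcdTop-∣top T)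

  gcdTop-∣ : ∀ T {y} → y ∈ₗ T → gcdTop T ∣ x y
  gcdTop-∣ (a ∷ T) (here refl) = gcd[m,n]∣m (x a) (gcdTop T)
  gcdTop-∣ (a ∷ T) (there y∈T) = ∣-trans (gcd[m,n]∣n (x a) (gcdTop T)) (gcdTop-∣ T y∈T)

  gcdTop-greatest : ∀ T {d} → d ∣ x j → All (λ y → d ∣ x y) T → d ∣ gcdTop T
  gcdTop-greatest [] d∣j [] = d∣j
  gcdTop-greatest (a ∷ T) d∣j (d∣a ∷ d∣T) = gcd-greatest d∣a (gcdTop-greatest T d∣j d∣T)

  gcdTop-∈S : ∀ T → ∃ λ c → x c ≡ gcdTop T
  gcdTop-∈S [] = j , refl
  gcdTop-∈S (a ∷ T) with gcdTop-∈S T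
  ... | c′ , xc′≡ with closed a c′
  ... | c , xc≡ = c , trans xc≡ (cong (gcd (x a)) xc′≡)

  gcdTop-pos : ∀ T → 0 < gcdTop T
  gcdTop-pos T with gcdTop-∈S T
  ... | c , xc≡ = subst (0 <_) xc≡ (x-pos c)

  xi∣gcdTop : ∀ T → All (_∈ₗ A) T → x i ∣ gcdTop T
  xi∣gcdTop T T⊆A = gcdTop-greatest T xi∣xj (All.map (proj₁ ∘ proj₁ ∘ ∈A⁻) T⊆A)

  -- The defining condition of c_ij, read through A:  d·x_i ∣ x_j and d·x_i divides
  -- no element of A.  (A multiple of d·x_i below x_j in S lies, by gcd-closedness,
  -- below a greatest-type divisor, which is then in A.)
  Avoids : ℕ → Set
  Avoids d = All (λ y → ¬ d * x i ∣ x y) A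

  CCond⇒Avoids : ∀ d → CCond x i j d → Avoids d
  CCond⇒Avoids d (_ , none-below) = All.tabulate (λ y∈A → none-below _ (proj₁ (proj₂ (∈A⁻ y∈A))))

  Avoids⇒CCond : ∀ d → d * x i ∣ x j → Avoids d → CCond x i j d
  Avoids⇒CCond d dxi∣j avoids = dxi∣j , none-below
    where
    none-below : ∀ t → x t < x j → ¬ d * x i ∣ x t
    none-below t t<j dxi∣t with closed t j
    ... | c , xc≡gcd with Gtd-above c c∣j c<j
      where
      c∣j : x c ∣ x j
      c∣j = subst (_∣ x j) (sym xc≡gcd) (gcd[m,n]∣n (x t) (x j))
      c<j : x c < x j
      c<j = ℕₚ.≤-<-trans (∣⇒≤ {{ℕ.>-nonZero (x-pos t)}} (subst (_∣ x t) (sym xc≡gcd) (gcd[m,n]∣m (x t) (x j)))) t<j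
    ... | y , y-gtd , c∣y = All.lookup avoids (∈A⁺ (Gtd⇒PM y-gtd (∣-trans (n∣m*n d) dxi∣y)) y-gtd) dxi∣y
      where
      dxi∣y : d * x i ∣ x y
      dxi∣y = ∣-trans (subst (d * x i ∣_) (sym xc≡gcd) (gcd-greatest dxi∣t dxi∣j)) c∣y

  gcdTop-guard : ∀ d T v → when (d * x i ∣? gcdTop T) v ≡ when (d * x i ∣? x j) (ifAll (λ y → d * x i ∣? x y) T v)
  gcdTop-guard d [] v = refl
  gcdTop-guard d (y ∷ T) v = begin
    when (d * x i ∣? gcd (x y) (gcdTop T)) v
      ≡⟨ when-× (d * x i ∣? gcd (x y) (gcdTop T)) (d * x i ∣? x y) (d * x i ∣? gcdTop T)
           (λ h → ∣-trans h (gcd[m,n]∣m (x y) (gcdTop T)) , ∣-trans h (gcd[m,n]∣n (x y) (gcdTop T))) gcd-greatest ⟩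
    when (d * x i ∣? x y) (when (d * x i ∣? gcdTop T) v)
      ≡⟨ cong (when (d * x i ∣? x y)) (gcdTop-guard d T v) ⟩
    when (d * x i ∣? x y) (when (d * x i ∣? x j) (ifAll (λ y → d * x i ∣? x y) T v))
      ≡⟨ when-comm (d * x i ∣? x y) (d * x i ∣? x j) ⟩
    when (d * x i ∣? x j) (ifAll (λ y → d * x i ∣? x y) (y ∷ T) v) ∎
    where open ≡-Reasoning

  CCond-as-altSum : ∀ d → when (CCond? x i j d) (μ d) ≡ altSum A (λ T → when (d * x i ∣? gcdTop T) (μ d))
  CCond-as-altSum d = sym (begin
    altSum A (λ T → when (d * x i ∣? gcdTop T) (μ d))
      ≡⟨ altSum-ext A (λ T → gcdTop-guard d T (μ d)) ⟩
    altSum A (λ T → when (d * x i ∣? x j) (ifAll divides? T (μ d)))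
      ≡⟨ altSum-when (d * x i ∣? x j) A (λ T → ifAll divides? T (μ d)) ⟩
    when (d * x i ∣? x j) (altSum A (λ T → ifAll divides? T (μ d)))
      ≡⟨ cong (when (d * x i ∣? x j)) (trans (altSum-ifAll divides? A (μ d)) (ifAll≡when-all (¬? ∘ divides?) A (μ d))) ⟩
    when (d * x i ∣? x j) (when (All.all? (¬? ∘ divides?) A) (μ d))
      ≡⟨ sym (when-× (CCond? x i j d) (d * x i ∣? x j) (All.all? (¬? ∘ divides?) A)
                (λ c → proj₁ c , CCond⇒Avoids d c) (Avoids⇒CCond d)) ⟩
    when (CCond? x i j d) (μ d) ∎)
    where
    open ≡-Reasoning
    divides? : ∀ y → Dec (d * x i ∣ x y)
    divides? y = d * x i ∣? x y

  -- Summing over d and using Σ_{d·x_i ∣ g} μ(d) = [g = x_i]: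
  -- c_ij = Σ_{T ⊆ A} (-1)^|T| [gcdTop T = x_i].
  cEntry≡altSum : cEntry x i j ≡ altSum A (λ T → when (gcdTop T ℕₚ.≟ x i) (+ 1))
  cEntry≡altSum = begin
    cEntry x i j
      ≡⟨ sumℤ≡sumBelow (x j) (λ e → when (CCond? x i j (suc e)) (μ (suc e))) ⟩
    sumBelow (x j) (λ e → when (CCond? x i j (suc e)) (μ (suc e)))
      ≡⟨ sumBelow-cong (x j) (λ e _ → CCond-as-altSum (suc e)) ⟩
    sumBelow (x j) (λ e → altSum A (term e))
      ≡⟨ sym (altSum-sumBelow A (x j) term) ⟩
    altSum A (λ T → sumBelow (x j) (λ e → term e T))
      ≡⟨ altSum-cong A A-unique (λ T _ T⊆A → möbius-sum-scaled (x i) (gcdTop T) (x j) (x-pos i)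
           (xi∣gcdTop T T⊆A) (gcdTop-pos T) (∣⇒≤ {{ℕ.>-nonZero (x-pos j)}} (gcdTop-∣top T))) ⟩
    altSum A (λ T → when (gcdTop T ℕₚ.≟ x i) (+ 1)) ∎
    where
    open ≡-Reasoning
    term : ℕ → List (Fin n) → ℤ
    term e T = when (suc e * x i ∣? gcdTop T) (μ (suc e))

  module _ (T : List (Fin n)) (T-gtd : All Gtd T) {a b : Fin n} (a∈T : a ∈ₗ T) (b∈T : b ∈ₗ T) (a≢b : a ≢ b) where

    -- gcdTop T is a proper divisor of each member, as G_S(x_j) is an antichain;
    gcdTop<member : ∀ {y} → y ∈ₗ T → gcdTop T < x y
    gcdTop<member {y} y∈T = ∣∧≢⇒< (x-pos y) (gcdTop-∣ T y∈T) gcd≢xy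
      where
      gcd≢xy : gcdTop T ≢ x y
      gcd≢xy gcd≡xy with y Finₚ.≟ a
      ... | no y≢a = y≢a (Gtd-antichain (All.lookup T-gtd y∈T) (All.lookup T-gtd a∈T) (subst (_∣ x a) gcd≡xy (gcdTop-∣ T a∈T)))
      ... | yes refl = a≢b (Gtd-antichain (All.lookup T-gtd y∈T) (All.lookup T-gtd b∈T) (subst (_∣ x b) gcd≡xy (gcdTop-∣ T b∈T)))

    -- and it belongs to D_S(x_j): it is the gcd of the subset {y | y ∈ T} of G_S(x_j).
    gcdTop-∈D : InD x j (gcdTop T)
    gcdTop-∈D = U , (λ y y∈U → All.lookup T-gtd (∈-subsetOf⁻ (_∈? T) y∈U)) , ∣U∣≥2 U (∈U a∈T) (∈U b∈T) a≢b ,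
                ∣-antisym gcdU∣gcdTop gcdTop∣gcdU
      where
      U : Subset n
      U = subsetOf (_∈? T)
      ∈U : ∀ {y} → y ∈ₗ T → y ∈ₛ U
      ∈U = ∈-subsetOf⁺ (_∈? T)
      gcdU∣gcdTop : gcdOf x U ∣ gcdTop T
      gcdU∣gcdTop = gcdTop-greatest T (∣-trans (gcdOf-∣ x U (∈U a∈T)) (proj₁ (proj₂ (All.lookup T-gtd a∈T))))
                      (All.tabulate (gcdOf-∣ x U ∘ ∈U))
      gcdTop∣gcdU : gcdTop T ∣ gcdOf x U
      gcdTop∣gcdU = gcdOf-greatest x U (λ y y∈U → gcdTop-∣ T (∈-subsetOf⁻ (_∈? T) y∈U))

  -- Below every element of D_i ∩ D_S(x_j) lies a minimal one.
  minimal-below : ∀ c → PM i c → InD x j (x c) → ¬ ¬ (∃ λ b → InMinDiDj x i j b × x b ∣ x c)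
  minimal-below c = descend (suc (x c)) c (ℕₚ.n<1+n _)
    where
    Below : Fin n → Set
    Below c = ∃ λ c′ → PM i c′ × InD x j (x c′) × x c′ ∣ x c × c′ ≢ c
    excluded-middle : ∀ {P : Set} → ¬ ¬ (P ⊎ ¬ P)
    excluded-middle k = k (inj₂ (k ∘ inj₁))
    descend : ∀ fuel c → x c < fuel → PM i c → InD x j (x c) → ¬ ¬ (∃ λ b → InMinDiDj x i j b × x b ∣ x c)
    descend (suc fuel) c c<fuel c∈Di c∈D k = excluded-middle {Below c} λ
      { (inj₁ (c′ , c′∈Di , c′∈D , c′∣c , c′≢c)) →
          descend fuel c′ (ℕₚ.<-≤-trans (∣∧≢⇒< (x-pos c) c′∣c (c′≢c ∘ x-inj)) (ℕ.s≤s⁻¹ c<fuel)) c′∈Di c′∈D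
            (λ { (b , b-min , b∣c′) → k (b , b-min , ∣-trans b∣c′ c′∣c) })
      ; (inj₂ ¬below) → k (c , ((c∈Di , c∈D) , minimal ¬below) , ∣-refl) }
      where
      minimal : ¬ Below c → ∀ c′ → PM i c′ → InD x j (x c′) → x c′ ∣ x c → c′ ≡ c
      minimal ¬below c′ c′∈Di c′∈D c′∣c with c′ Finₚ.≟ c
      ... | yes c′≡c = c′≡c
      ... | no c′≢c = ⊥-elim (¬below (c′ , c′∈Di , c′∈D , c′∣c , c′≢c))

  altSum-several : ∀ a → (∀ {b} → PM a b → PM i b) → 1 ≤ length (filter (PM? a) A) →
    altSum A (severalAll (PM? a)) ≡ + lCount x j a - + 1
  altSum-several a Da⊆Di A∩Da≢∅ =
    trans (altSum-severalAll (PM? a) A A∩Da≢∅) (cong (λ l → + l - + 1) (count-A∩D a Da⊆Di))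

  A∩Di-nonempty : 1 ≤ length (filter (PM? i) A)
  A∩Di-nonempty with xi-below
  ... | a , a-gtd , xi∣a , _ = length≥1 (∈-filter⁺ (PM? i) (∈A⁺ (Gtd⇒PM a-gtd xi∣a) a-gtd) (Gtd⇒PM a-gtd xi∣a))

  module MinimalElements (k : ℕ) (m : Fin k → Fin n)
    (minimal⇔ : ∀ b → InMinDiDj x i j b ⇔ (∃ λ t → m t ≡ b))
    (pairwise : 2 ≤ k → ∀ (r t : Fin k) → r <ᶠ t → lCount2 x j (m r) (m t) ≤ 1) where

    m-minimal : ∀ t → InMinDiDj x i j (m t)
    m-minimal t = Equivalence.from (minimal⇔ (m t)) (t , refl)

    Dm⊆Di : ∀ t {b} → PM (m t) b → PM i b
    Dm⊆Di t (m∣b , m<b) with proj₁ (proj₁ (m-minimal t))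
    ... | xi∣m , xi<m = ∣-trans xi∣m m∣b , ℕₚ.<-trans xi<m m<b

    A∩Dm-nonempty : ∀ t → 1 ≤ length (filter (PM? (m t)) A)
    A∩Dm-nonempty t with D-below-Gtd (proj₂ (proj₁ (m-minimal t)))
    ... | a , a-gtd , m∣a , m<a = length≥1 (∈-filter⁺ (PM? (m t)) (∈A⁺ (Dm⊆Di t (m∣a , m<a)) a-gtd) (m∣a , m<a))

    Shared : Fin k → Fin k → Fin n → Set
    Shared r t y = PM (m r) y × PM (m t) y × Gtd y

    Shared-swap : ∀ {r t y} → Shared r t y → Shared t r y
    Shared-swap (y∈Dr , y∈Dt , y-gtd) = y∈Dt , y∈Dr , y-gtd

    two-shared : ∀ {r t a b} → r <ᶠ t → a ≢ b → Shared r t a → Shared r t b → ⊥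
    two-shared {r} {t} r<t a≢b a-shared b-shared = ℕₚ.<⇒≱ (s≤s (s≤s z≤n)) (ℕₚ.≤-trans 2≤count (pairwise 2≤k r t r<t))
      where
      R? : ∀ y → Dec (Shared r t y)
      R? y = PM? (m r) y ×-dec PM? (m t) y ×-dec IsGreatestTypeDivisor? x j y
      2≤count : 2 ≤ lCount2 x j (m r) (m t)
      2≤count = subst (2 ≤_) (length-filter-tabulate R? (λ y → y))
        (length≥2 (∈-filter⁺ R? (∈-allFin _) a-shared) (∈-filter⁺ R? (∈-allFin _) b-shared) a≢b)
      2≤k : 2 ≤ k
      2≤k = ℕₚ.≤-trans (s≤s (ℕₚ.≤-trans (s≤s z≤n) r<t)) (Finₚ.toℕ<n t)

    shared≤1 : ∀ {r t a b} → r ≢ t → a ≢ b → Shared r t a → Shared r t b → ⊥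
    shared≤1 {r} {t} r≢t a≢b a-shared b-shared with Finₚ.<-cmp r t
    ... | tri< r<t _ _ = two-shared r<t a≢b a-shared b-shared
    ... | tri≈ _ r≡t _ = r≢t r≡t
    ... | tri> _ _ t<r = two-shared t<r a≢b (Shared-swap a-shared) (Shared-swap b-shared)

    module _ (T : List (Fin n)) (T⊆A : All (_∈ₗ A) T) {a b : Fin n} (a∈T : a ∈ₗ T) (b∈T : b ∈ₗ T) (a≢b : a ≢ b) where

      T-gtd : All Gtd T
      T-gtd = All.map (proj₂ ∘ ∈A⁻) T⊆A

      T⊆D : Fin k → ℤ
      T⊆D t = ifAll (PM? (m t)) T (+ 1)

      -- If gcdTop T = x_i, none does: x_{m t} would divide x_i < x_{m t}.
      contained-in-none : gcdTop T ≡ x i → ∀ t → T⊆D t ≡ + 0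
      contained-in-none gcd≡xi t = ifAll-no (PM? (m t)) T λ T⊆Dm →
        ℕₚ.<⇒≱ (proj₂ (proj₁ (proj₁ (m-minimal t))))
          (∣⇒≤ {{ℕ.>-nonZero (x-pos i)}} (subst (x (m t) ∣_) gcd≡xi
            (gcdTop-greatest T (∣-trans (proj₁ (All.lookup T⊆Dm a∈T)) (proj₁ (proj₂ (All.lookup T-gtd a∈T))))
                               (All.map proj₁ T⊆Dm))))

      -- Otherwise exactly one does: the minimal element below gcdTop T ∈ D_i ∩ D_S(x_j),
      -- and no other one by the hypothesis on shared greatest-type divisors.
      contained-in-one : gcdTop T ≢ x i → sumℤ T⊆D ≡ + 1
      contained-in-one gcd≢xi with gcdTop-∈S T
      ... | c , xc≡gcd = decidable-stable (sumℤ T⊆D ℤₚ.≟ + 1) λ sum≢1 →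
            minimal-below c c∈Di c∈D (λ { (w , w-min , w∣c) → sum≢1 (exactly-one w w-min w∣c) })
        where
        c∈Di : PM i c
        c∈Di = xi∣c , ∣∧≢⇒< (x-pos c) xi∣c (λ xi≡xc → gcd≢xi (trans (sym xc≡gcd) (sym xi≡xc)))
          where
          xi∣c : x i ∣ x c
          xi∣c = subst (x i ∣_) (sym xc≡gcd) (xi∣gcdTop T T⊆A)
        c∈D : InD x j (x c)
        c∈D = subst (InD x j) (sym xc≡gcd) (gcdTop-∈D T T-gtd a∈T b∈T a≢b)
        exactly-one : ∀ w → InMinDiDj x i j w → x w ∣ x c → sumℤ T⊆D ≡ + 1
        exactly-one w w-min w∣c with Equivalence.to (minimal⇔ w) w-min
        ... | t₀ , refl = sumℤ-single k t₀ (ifAll-yes (PM? (m t₀)) T T⊆Dt₀) λ t t≢t₀ →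
              ifAll-no (PM? (m t)) T λ T⊆Dt → shared≤1 t≢t₀ a≢b (shared T⊆Dt a∈T) (shared T⊆Dt b∈T)
          where
          T⊆Dt₀ : All (PM (m t₀)) T
          T⊆Dt₀ = All.tabulate λ {y} y∈T →
            ∣-trans w∣c (subst (_∣ x y) (sym xc≡gcd) (gcdTop-∣ T y∈T)) ,
            ℕₚ.≤-<-trans (∣⇒≤ {{ℕ.>-nonZero (x-pos c)}} w∣c)
                         (subst (_< x y) (sym xc≡gcd) (gcdTop<member T T-gtd a∈T b∈T a≢b y∈T))
          shared : ∀ {t y} → All (PM (m t)) T → y ∈ₗ T → Shared t t₀ y
          shared T⊆Dt y∈T = All.lookup T⊆Dt y∈T , All.lookup T⊆Dt₀ y∈T , All.lookup T-gtd y∈T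

    indicator-decomposition : ∀ T → Unique T → All (_∈ₗ A) T →
      when (gcdTop T ℕₚ.≟ x i) (+ 1) ≡ severalAll (PM? i) T - sumℤ (λ t → severalAll (PM? (m t)) T)
    indicator-decomposition [] _ _ =
      trans (when-no (x j ℕₚ.≟ x i) (ℕₚ.>⇒≢ xi<xj)) (sym (cong (_-_ (+ 0)) (sumℤ-0 k (λ _ → refl))))
    indicator-decomposition (y ∷ []) _ (y∈A ∷ []) =
      trans (when-no (gcd (x y) (x j) ℕₚ.≟ x i) gcd≢xi) (sym (cong (_-_ (+ 0)) (sumℤ-0 k (λ _ → refl))))
      where
      gcd≡xy : gcd (x y) (x j) ≡ x y
      gcd≡xy = ∣-antisym (gcd[m,n]∣m (x y) (x j)) (gcd-greatest ∣-refl (proj₁ (proj₂ (proj₂ (∈A⁻ y∈A)))))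
      gcd≢xi : gcd (x y) (x j) ≢ x i
      gcd≢xi gcd≡xi = ℕₚ.<⇒≢ (proj₂ (proj₁ (∈A⁻ y∈A))) (trans (sym gcd≡xi) gcd≡xy)
    indicator-decomposition T@(a ∷ b ∷ _) ((a≢b ∷ _) ∷ _) T⊆A =
      trans (by-gcd (gcdTop T ℕₚ.≟ x i))
            (cong (_- sumℤ (T⊆D T T⊆A a∈T b∈T a≢b)) (sym (ifAll-yes (PM? i) T (All.map (proj₁ ∘ ∈A⁻) T⊆A))))
      where
      a∈T : a ∈ₗ T
      a∈T = here refl
      b∈T : b ∈ₗ T
      b∈T = there (here refl)
      by-gcd : (D : Dec (gcdTop T ≡ x i)) → when D (+ 1) ≡ + 1 - sumℤ (T⊆D T T⊆A a∈T b∈T a≢b)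
      by-gcd (yes gcd≡xi) = sym (cong (_-_ (+ 1)) (sumℤ-0 k (contained-in-none T T⊆A a∈T b∈T a≢b gcd≡xi)))
      by-gcd (no gcd≢xi) = sym (cong (_-_ (+ 1)) (contained-in-one T T⊆A a∈T b∈T a≢b gcd≢xi))

lemma2p6 : (n : ℕ) (x : Fin n → ℕ) → Injective _≡_ _≡_ x → (∀ a → 0 < x a) → GcdClosed x →
    (i j : Fin n) → InD x j (x i) →
    (∃ λ b → IsProperMultiple x i b × InD x j (x b)) →
    (k : ℕ) (m : Fin k → Fin n) → Injective _≡_ _≡_ m →
    (∀ b → InMinDiDj x i j b ⇔ (∃ λ t → m t ≡ b)) →
    (2 ≤ k → ∀ (r t : Fin k) → r <ᶠ t → lCount2 x j (m r) (m t) ≤ 1) →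
    cEntry x i j ≡ (+ lCount x j i - sumℤ (λ t → + lCount x j (m t))) + (+ k - + 1)
lemma2p6 n x x-inj x-pos closed i j xi∈D _ k m _ minimal⇔ pairwise = begin
  cEntry x i j
    ≡⟨ cEntry≡altSum ⟩
  altSum A (λ T → when (gcdTop T ℕₚ.≟ x i) (+ 1))
    ≡⟨ altSum-cong A A-unique indicator-decomposition ⟩
  altSum A (λ T → severalAll (PM? i) T - sumℤ (λ t → severalAll (PM? (m t)) T))
    ≡⟨ altSum-- A (severalAll (PM? i)) (λ T → sumℤ (λ t → severalAll (PM? (m t)) T)) ⟩
  altSum A (severalAll (PM? i)) - altSum A (λ T → sumℤ (λ t → severalAll (PM? (m t)) T))
    ≡⟨ cong (_-_ (altSum A (severalAll (PM? i)))) (altSum-sumℤ A k (λ t → severalAll (PM? (m t)))) ⟩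
  altSum A (severalAll (PM? i)) - sumℤ (λ t → altSum A (severalAll (PM? (m t))))
    ≡⟨ cong₂ _-_ (altSum-several i (λ h → h) A∩Di-nonempty)
                 (sumℤ-cong k (λ t → altSum-several (m t) (Dm⊆Di t) (A∩Dm-nonempty t))) ⟩
  (+ lCount x j i - + 1) - sumℤ (λ t → + lCount x j (m t) - + 1)
    ≡⟨ cong (_-_ (+ lCount x j i - + 1)) (sumℤ-minus1 k (λ t → + lCount x j (m t))) ⟩
  (+ lCount x j i - + 1) - (sumℤ (λ t → + lCount x j (m t)) - + k)
    ≡⟨ regroup (+ lCount x j i) (sumℤ (λ t → + lCount x j (m t))) (+ k) ⟩
  (+ lCount x j i - sumℤ (λ t → + lCount x j (m t))) + (+ k - + 1) ∎
  where
  open ≡-Reasoning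
  open Entry x x-inj x-pos closed i j xi∈D
  open MinimalElements k m minimal⇔ pairwise
  regroup : ∀ l s κ → (l - + 1) - (s - κ) ≡ (l - s) + (κ - + 1)
  regroup = solve-∀
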